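{- Let $n$ be a positive integer and let $(\mathcal{S},\mathcal{B})$ be a Kirkman triple system of order $n$ on the point set $\mathcal{S}=\{0,1,\dots,n-1\}$ with $\min_\Sigma(\mathcal{B}) = n$. Then there exists a Kirkman triple system $(\mathcal{S}',\mathcal{B}')$ of order $3n$ on the point set $\mathcal{S}'=\{0,1,\dots,3n-1\}$ with $\min_\Sigma(\mathcal{B}') = 3n$.
   Context: A Steiner triple system of order $n$ is a pair $(\mathcal{S},\mathcal{B})$ where $\mathcal{S}$ is a set of $n$ elements and $\mathcal{B}$ is a set of 3-element subsets of $\mathcal{S}$ (blocks) such that every 2-element subset of $\mathcal{S}$ is contained in exactly one block. A parallel class is a subset of $\mathcal{B}$ that partitions $\mathcal{S}$; the system is resolvable if $\mathcal{B}$ can be partitioned into parallel classes. A Kirkman triple system of order $n$, $KTS(n)$, is a resolvable Steiner triple system of order $n$. For a design $(\mathcal{S},\mathcal{B})$ with $\mathcal{S}=\{0,1,\dots,n-1\}$, the min-sum is $\min_\Sigma(\mathcal{B}) := \min_{B\in\mathcal{B}} \sum_{x\in B} x$. -}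

module Defs where

open import Data.Nat using (ℕ; _+_; _<_; _≥_)
open import Data.Fin using (Fin; toℕ)
open import Data.Sum using (_⊎_)
open import Data.Product using (Σ; _×_; _,_; ∃; ∃-syntax)
open import Data.List using (List; concat)
open import Data.List.Membership.Propositional using (_∈_)
open import Data.List.Relation.Unary.Unique.Propositional using (Unique)
open import Data.List.Relation.Binary.Permutation.Propositional using (_↭_)
open import Relation.Binary.PropositionalEquality using (_≡_)
open import Relation.Nullary using (¬_)

-- A block (3-element subset of {0,…,n-1}) is represented canonically as an
-- increasing triple a < b < c of elements of Fin n.
record Block (n : ℕ) : Set where
  constructor blk
  field
    a b c : Fin n
    a<b : toℕ a < toℕ b
    b<c : toℕ b < toℕ c
open Block public

_∈B_ : ∀ {n} → Fin n → Block n → Set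
x ∈B B = (x ≡ a B) ⊎ ((x ≡ b B) ⊎ (x ≡ c B))

record IsSTS (n : ℕ) (𝓑 : List (Block n)) : Set where
  field
    unique   : Unique 𝓑
    covered  : ∀ (x y : Fin n) → ¬ x ≡ y → ∃[ B ] (B ∈ 𝓑 × x ∈B B × y ∈B B)
    onlyOnce : ∀ (x y : Fin n) → ¬ x ≡ y → ∀ B B′ → B ∈ 𝓑 → B′ ∈ 𝓑 →
               x ∈B B → y ∈B B → x ∈B B′ → y ∈B B′ → B ≡ B′

record IsParallelClass (n : ℕ) (P : List (Block n)) : Set where
  field
    unique   : Unique P
    covers   : ∀ (x : Fin n) → ∃[ B ] (B ∈ P × x ∈B B)
    disjoint : ∀ (x : Fin n) → ∀ B B′ → B ∈ P → B′ ∈ P → x ∈B B → x ∈B B′ → B ≡ B′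

record Resolution (n : ℕ) (𝓑 : List (Block n)) : Set where
  field
    classes    : List (List (Block n))
    isParallel : ∀ P → P ∈ classes → IsParallelClass n P
    partition  : concat classes ↭ 𝓑

record IsKTS (n : ℕ) (𝓑 : List (Block n)) : Set where
  field
    sts        : IsSTS n 𝓑
    resolvable : Resolution n 𝓑

blockSum : ∀ {n} → Block n → ℕ
blockSum B = toℕ (a B) + toℕ (b B) + toℕ (c B)

MinSumIs : ∀ {n} → List (Block n) → ℕ → Set
MinSumIs 𝓑 m = (∃[ B ] (B ∈ 𝓑 × blockSum B ≡ m)) × (∀ B → B ∈ 𝓑 → blockSum B ≥ m)

-- Points of the tripled system are pairs (u , t) of a point u of the old system and
-- a layer t ∈ ℤ₃, encoded as n t + u.  Its blocks are the verticals {u} × ℤ₃ and,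
-- for every old block {a < b < c} and i, j ∈ ℤ₃, the lift {(a , i), (b , j), (c , k)}
-- with i + j + k ≡ 2 (mod 3).  The layer triples (i , j , k) form a Latin square, so two
-- points in different columns lie in exactly one lift, and for fixed s the lifts of
-- the blocks of one parallel class with j − i = s again form a parallel class.
-- A vertical has sum 3n + 3u ≥ 3n, a lift has sum Σ B + n (i + j + k) ≥ n + 2n,
-- with equality for the lift with i = j = 0 of an old block of sum n.
module Submission where

open import Defs
open import Data.Nat using (ℕ; _*_; NonZero)
open import Data.Product using (Σ; _×_; ∃-syntax)
open import Data.List using (List)

open import Algebra.Properties.CommutativeSemigroup using (xy∙z≈xz∙y)
open import Data.Empty using (⊥; ⊥-elim)
open import Data.Fin using (Fin; toℕ; combine; remQuot)
open import Data.Fin.Patterns using (0F; 1F; 2F)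
open import Data.Fin.Properties
  using (_≟_; <-cmp; <⇒≢; <-trans; all?; any?; toℕ-combine; combine-remQuot; remQuot-combine; combine-injective)
open import Data.List using ([]; _∷_; _++_; map; concat; concatMap; allFin)
open import Data.List.Properties using (concat-map; concat-concat; concatMap-map; concatMap-cong)
open import Data.List.Membership.Propositional using (_∈_; find; lose)
open import Data.List.Membership.Propositional.Properties
  using (∈-map⁺; ∈-map⁻; ∈-concat⁺′; ∈-concatMap⁺; ∈-concatMap⁻; ∈-++⁺ˡ; ∈-++⁺ʳ; ∈-++⁻;
         ∈-allFin)
open import Data.List.Relation.Unary.Any using (here; there)
import Data.List.Relation.Unary.All as All
open import Data.List.Relation.Unary.AllPairs using ([]; _∷_)
open import Data.List.Relation.Unary.Unique.Propositional using (Unique)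
open import Data.List.Relation.Unary.Unique.Propositional.Properties using (map⁺; ++⁺; allFin⁺)
open import Data.List.Relation.Binary.Disjoint.Propositional using (Disjoint)
open import Data.List.Relation.Binary.Permutation.Propositional using (↭-sym; ↭-reflexive; ↭⇒↭ₛ)
open import Data.List.Relation.Binary.Permutation.Propositional.Properties using (∈-resp-↭)
open import Data.List.Relation.Binary.Permutation.Setoid.Properties using (Unique-resp-↭)
open import Data.Nat using (_+_; _<_; _≤_; _≥_; _≤?_)
open import Data.Nat.Properties
  using (+-comm; +-commutativeSemigroup; m≤m+n; +-mono-≤; *-monoʳ-≤; module ≤-Reasoning)
open import Data.Nat.Tactic.RingSolver using (solve-∀)
open import Data.Product using (_,_; ∃₂; proj₁; proj₂)
import Data.Product as Product
open import Data.Sum using (_⊎_; [_,_]; inj₁; inj₂; swap; map₁; map₂; assocʳ; assocˡ)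
open import Data.Unit using (tt)
open import Function using (_∘_; id; case_of_; _⇔_; mk⇔; Equivalence; Injective)
open import Relation.Binary using (tri<; tri≈; tri>)
open import Relation.Binary.PropositionalEquality
  using (_≡_; _≢_; refl; sym; trans; cong; cong₂; subst; setoid; module ≡-Reasoning)
open import Relation.Nullary using (yes; no)
open import Relation.Nullary.Decidable using (toWitness; _×-dec_; _→-dec_; ¬?)

Unique-concatMap⁺ : ∀ {A B : Set} (f : A → List B) {xs : List A} → Unique xs →
  (∀ {x} → x ∈ xs → Unique (f x)) →
  (∀ {x x′ y} → x ∈ xs → x′ ∈ xs → y ∈ f x → y ∈ f x′ → x ≡ x′) →
  Unique (concatMap f xs)
Unique-concatMap⁺ f {[]}     _           _  _          = []
Unique-concatMap⁺ f {x ∷ xs} (x∉ ∷ xs!) f! determined =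
  ++⁺ (f! (here refl))
      (Unique-concatMap⁺ f xs! (f! ∘ there) (λ h h′ → determined (there h) (there h′)))
      disjoint
  where
  disjoint : Disjoint (f x) (concatMap f xs)
  disjoint (y∈fx , y∈rest) with find (∈-concatMap⁻ f y∈rest)
  ... | x′ , x′∈xs , y∈fx′ = All.lookup x∉ x′∈xs (determined (here refl) (there x′∈xs) y∈fx y∈fx′)

concat-concatMap : ∀ {A B : Set} (f : A → List (List B)) xs →
  concat (concatMap f xs) ≡ concatMap (concat ∘ f) xs
concat-concatMap f xs = trans (sym (concat-concat (map f xs))) (concatMap-map concat f xs)

concat-map-concatMap : ∀ {A B : Set} (f : A → List B) xss →
  concat (map (concatMap f) xss) ≡ concatMap f (concat xss)
concat-map-concatMap f xss = begin
  concat (map (concatMap f) xss)          ≡⟨ concatMap-map concat (map f) xss ⟨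
  concat (map concat (map (map f) xss))   ≡⟨ concat-concat (map (map f) xss) ⟩
  concat (concat (map (map f) xss))       ≡⟨ cong concat (concat-map xss) ⟩
  concatMap f (concat xss)                ∎
  where open ≡-Reasoning

-- ℤ₃ and the Latin square of layer triples

infixl 6 _⊕_ _⊖_

_⊕_ : Fin 3 → Fin 3 → Fin 3
0F ⊕ t  = t
1F ⊕ 0F = 1F
1F ⊕ 1F = 2F
1F ⊕ 2F = 0F
2F ⊕ 0F = 2F
2F ⊕ 1F = 0F
2F ⊕ 2F = 1F

_⊖_ : Fin 3 → Fin 3 → Fin 3
t  ⊖ 0F = t
0F ⊖ 1F = 2F
1F ⊖ 1F = 0F
2F ⊖ 1F = 1F
0F ⊖ 2F = 1F
1F ⊖ 2F = 2F
2F ⊖ 2F = 0F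

third : Fin 3 → Fin 3 → Fin 3
third i j = 2F ⊖ (i ⊕ j)

layers : Fin 3 → Fin 3 → Fin 3 → Fin 3
layers i j 0F = i
layers i j 1F = j
layers i j 2F = third i j

⊕-⊖-cancel : ∀ i j → i ⊕ (j ⊖ i) ≡ j
⊕-⊖-cancel = toWitness {a? = all? λ i → all? λ j → i ⊕ (j ⊖ i) ≟ j} tt

⊕-cancelˡ : ∀ i s s′ → i ⊕ s ≡ i ⊕ s′ → s ≡ s′
⊕-cancelˡ = toWitness {a? = all? λ i → all? λ s → all? λ s′ → (i ⊕ s ≟ i ⊕ s′) →-dec (s ≟ s′)} tt

layers-pair-surjective : ∀ α β t t′ → α ≢ β → ∃₂ λ i j → layers i j α ≡ t × layers i j β ≡ t′
layers-pair-surjective = toWitness {a? = all? λ α → all? λ β → all? λ t → all? λ t′ →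
  ¬? (α ≟ β) →-dec any? λ i → any? λ j → (layers i j α ≟ t) ×-dec (layers i j β ≟ t′)} tt

layers-pair-injective : ∀ α β i j i′ j′ → α ≢ β →
  layers i j α ≡ layers i′ j′ α → layers i j β ≡ layers i′ j′ β → i ≡ i′ × j ≡ j′
layers-pair-injective = toWitness {a? = all? λ α → all? λ β → all? λ i → all? λ j →
  all? λ i′ → all? λ j′ →
  ¬? (α ≟ β) →-dec (layers i j α ≟ layers i′ j′ α) →-dec (layers i j β ≟ layers i′ j′ β) →-dec
  ((i ≟ i′) ×-dec (j ≟ j′))} tt

diagonal-layer-surjective : ∀ α s t → ∃[ i ] layers i (i ⊕ s) α ≡ t
diagonal-layer-surjective = toWitness {a? = all? λ α → all? λ s → all? λ t →
  any? λ i → layers i (i ⊕ s) α ≟ t} tt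

diagonal-point-injectiveʳ : ∀ α s i i′ → layers i (i ⊕ s) α ≡ layers i′ (i′ ⊕ s) α → i ≡ i′
diagonal-point-injectiveʳ = toWitness {a? = all? λ α → all? λ s → all? λ i → all? λ i′ →
  (layers i (i ⊕ s) α ≟ layers i′ (i′ ⊕ s) α) →-dec (i ≟ i′)} tt

layers-sum≥2 : ∀ i j → 2 ≤ toℕ i + toℕ j + toℕ (third i j)
layers-sum≥2 = toWitness {a? = all? λ i → all? λ j → 2 ≤? toℕ i + toℕ j + toℕ (third i j)} tt

module _ {A : Set} {x : A} (f : Fin 3 → A) where

  ⊎₃⇒∃ : x ≡ f 0F ⊎ x ≡ f 1F ⊎ x ≡ f 2F → ∃[ α ] x ≡ f α
  ⊎₃⇒∃ (inj₁ e)        = 0F , e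
  ⊎₃⇒∃ (inj₂ (inj₁ e)) = 1F , e
  ⊎₃⇒∃ (inj₂ (inj₂ e)) = 2F , e

  ∃⇒⊎₃ : ∀ α → x ≡ f α → x ≡ f 0F ⊎ x ≡ f 1F ⊎ x ≡ f 2F
  ∃⇒⊎₃ 0F e = inj₁ e
  ∃⇒⊎₃ 1F e = inj₂ (inj₁ e)
  ∃⇒⊎₃ 2F e = inj₂ (inj₂ e)

corner : ∀ {m} → Block m → Fin 3 → Fin m
corner B 0F = a B
corner B 1F = b B
corner B 2F = c B

∈B⇒corner : ∀ {m} (B : Block m) {x} → x ∈B B → ∃[ α ] x ≡ corner B α
∈B⇒corner B = ⊎₃⇒∃ (corner B)

corner⇒∈B : ∀ {m} (B : Block m) {x} α → x ≡ corner B α → x ∈B B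
corner⇒∈B B = ∃⇒⊎₃ (corner B)

corner-injective : ∀ {m} (B : Block m) → Injective _≡_ _≡_ (corner B)
corner-injective B {0F} {0F} e = refl
corner-injective B {0F} {1F} e = ⊥-elim (<⇒≢ (a<b B) e)
corner-injective B {0F} {2F} e = ⊥-elim (<⇒≢ (<-trans (a<b B) (b<c B)) e)
corner-injective B {1F} {0F} e = ⊥-elim (<⇒≢ (a<b B) (sym e))
corner-injective B {1F} {1F} e = refl
corner-injective B {1F} {2F} e = ⊥-elim (<⇒≢ (b<c B) e)
corner-injective B {2F} {0F} e = ⊥-elim (<⇒≢ (<-trans (a<b B) (b<c B)) (sym e))
corner-injective B {2F} {1F} e = ⊥-elim (<⇒≢ (b<c B) (sym e))
corner-injective B {2F} {2F} e = refl

record Sorting {m} (p q r : Fin m) : Set where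
  field
    block   : Block m
    members : ∀ {x} → x ∈B block ⇔ (x ≡ p ⊎ x ≡ q ⊎ x ≡ r)
    sum     : blockSum block ≡ toℕ p + toℕ q + toℕ r

module _ {m} {p q r : Fin m} where
  open Sorting
  open Equivalence

  ascending : toℕ p < toℕ q → toℕ q < toℕ r → Sorting p q r
  ascending p<q q<r = record { block = blk p q r p<q q<r ; members = mk⇔ id id ; sum = refl }

  swap₁₂ : Sorting q p r → Sorting p q r
  swap₁₂ S = record
    { block   = block S
    ; members = mk⇔ (exchange ∘ to (members S)) (from (members S) ∘ exchange)
    ; sum     = trans (sum S) (cong (_+ toℕ r) (+-comm (toℕ q) (toℕ p)))
    }
    where
    exchange : ∀ {A B C : Set} → A ⊎ B ⊎ C → B ⊎ A ⊎ C
    exchange = assocʳ ∘ map₁ swap ∘ assocˡ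

  swap₂₃ : Sorting p r q → Sorting p q r
  swap₂₃ S = record
    { block   = block S
    ; members = mk⇔ (map₂ swap ∘ to (members S)) (from (members S) ∘ map₂ swap)
    ; sum     = trans (sum S) (xy∙z≈xz∙y +-commutativeSemigroup (toℕ p) (toℕ r) (toℕ q))
    }

sort₃ : ∀ {m} (p q r : Fin m) → p ≢ q → q ≢ r → p ≢ r → Sorting p q r
sort₃ p q r p≢q q≢r p≢r with <-cmp p q | <-cmp q r | <-cmp p r
... | tri≈ _ p≡q _ | _            | _            = ⊥-elim (p≢q p≡q)
... | _            | tri≈ _ q≡r _ | _            = ⊥-elim (q≢r q≡r)
... | _            | _            | tri≈ _ p≡r _ = ⊥-elim (p≢r p≡r)
... | tri< p<q _ _ | tri< q<r _ _ | _            = ascending p<q q<r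
... | tri< _ _ _   | tri> _ _ r<q | tri< p<r _ _ = swap₂₃ (ascending p<r r<q)
... | tri< p<q _ _ | tri> _ _ _   | tri> _ _ r<p = swap₂₃ (swap₁₂ (ascending r<p p<q))
... | tri> _ _ q<p | tri< _ _ _   | tri< p<r _ _ = swap₁₂ (ascending q<p p<r)
... | tri> _ _ _   | tri< q<r _ _ | tri> _ _ r<p = swap₁₂ (swap₂₃ (ascending q<r r<p))
... | tri> _ _ q<p | tri> _ _ r<q | _            = swap₁₂ (swap₂₃ (swap₁₂ (ascending r<q q<p)))

module _ {m} (f : Fin 3 → Fin m) (f-injective : Injective _≡_ _≡_ f) where
  private
    distinct : ∀ {α β} → α ≢ β → f α ≢ f β
    distinct α≢β = α≢β ∘ f-injective

    sorting : Sorting (f 0F) (f 1F) (f 2F)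
    sorting = sort₃ _ _ _ (distinct λ ()) (distinct λ ()) (distinct λ ())

  -- Abstract because unfolding the sort makes later unification problems very expensive.
  abstract
    tripleBlock : Block m
    tripleBlock = Sorting.block sorting

    ∈tripleBlock⁻ : ∀ {x} → x ∈B tripleBlock → ∃[ α ] x ≡ f α
    ∈tripleBlock⁻ = ⊎₃⇒∃ f ∘ Equivalence.to (Sorting.members sorting)

    ∈tripleBlock⁺ : ∀ {x} α → x ≡ f α → x ∈B tripleBlock
    ∈tripleBlock⁺ α = Equivalence.from (Sorting.members sorting) ∘ ∃⇒⊎₃ f α

    blockSum-tripleBlock : blockSum tripleBlock ≡ toℕ (f 0F) + toℕ (f 1F) + toℕ (f 2F)
    blockSum-tripleBlock = Sorting.sum sorting

-- Points and blocks of the tripled system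

module Tripled (n : ℕ) where

  point : Fin n → Fin 3 → Fin (3 * n)
  point u t = combine t u

  column : Fin (3 * n) → Fin n
  column x = proj₂ (remQuot {3} n x)

  layer : Fin (3 * n) → Fin 3
  layer x = proj₁ (remQuot {3} n x)

  toℕ-point : ∀ u t → toℕ (point u t) ≡ n * toℕ t + toℕ u
  toℕ-point u t = toℕ-combine t u

  column-point : ∀ u t → column (point u t) ≡ u
  column-point u t = cong proj₂ (remQuot-combine t u)

  layer-point : ∀ u t → layer (point u t) ≡ t
  layer-point u t = cong proj₁ (remQuot-combine t u)

  point-injective : ∀ u t u′ t′ → point u t ≡ point u′ t′ → u ≡ u′ × t ≡ t′
  point-injective u t u′ t′ = Product.swap ∘ combine-injective t u t′ u′

  ≡point : ∀ {x u t} → column x ≡ u → layer x ≡ t → x ≡ point u t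
  ≡point {x} refl refl = sym (combine-remQuot {3} n x)

  column-layer-injective : ∀ {x y} → column x ≡ column y → layer x ≡ layer y → x ≡ y
  column-layer-injective c l = trans (≡point c l) (sym (≡point refl refl))

  point-injectiveʳ : ∀ u → Injective _≡_ _≡_ (point u)
  point-injectiveʳ u {t} {t′} = proj₂ ∘ point-injective u t u t′

  vertical : Fin n → Block (3 * n)
  vertical u = tripleBlock (point u) (point-injectiveʳ u)

  ∈vertical⁻ : ∀ u {x} → x ∈B vertical u → column x ≡ u
  ∈vertical⁻ u x∈ with ∈tripleBlock⁻ (point u) (point-injectiveʳ u) x∈
  ... | t , refl = column-point u t

  ∈vertical⁺ : ∀ u {x} → column x ≡ u → x ∈B vertical u
  ∈vertical⁺ u {x} cx = ∈tripleBlock⁺ (point u) (point-injectiveʳ u) (layer x) (≡point cx refl)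

  vertical-injective : ∀ {u u′} → vertical u ≡ vertical u′ → u ≡ u′
  vertical-injective {u} {u′} e =
    trans (sym (column-point u 0F)) (∈vertical⁻ u′ (subst (_ ∈B_) e (∈vertical⁺ u (column-point u 0F))))

  ∈vertical-same-column : ∀ u {x y} → x ∈B vertical u → y ∈B vertical u → column x ≡ column y
  ∈vertical-same-column u x∈ y∈ = trans (∈vertical⁻ u x∈) (sym (∈vertical⁻ u y∈))

  verticals-through : ∀ u u′ {x} → x ∈B vertical u → x ∈B vertical u′ → vertical u ≡ vertical u′
  verticals-through u u′ x∈ x∈′ = cong vertical (trans (sym (∈vertical⁻ u x∈)) (∈vertical⁻ u′ x∈′))

  blockSum-vertical : ∀ u → blockSum (vertical u) ≡ 3 * n + 3 * toℕ u
  blockSum-vertical u = begin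
    blockSum (vertical u)
      ≡⟨ blockSum-tripleBlock (point u) (point-injectiveʳ u) ⟩
    toℕ (point u 0F) + toℕ (point u 1F) + toℕ (point u 2F)
      ≡⟨ cong₂ _+_ (cong₂ _+_ (toℕ-point u 0F) (toℕ-point u 1F)) (toℕ-point u 2F) ⟩
    n * 0 + toℕ u + (n * 1 + toℕ u) + (n * 2 + toℕ u)
      ≡⟨ regroup n (toℕ u) ⟩
    3 * n + 3 * toℕ u ∎
    where
    open ≡-Reasoning
    regroup : ∀ n u → n * 0 + u + (n * 1 + u) + (n * 2 + u) ≡ 3 * n + 3 * u
    regroup = solve-∀

  liftPoint : Fin 3 → Fin 3 → Block n → Fin 3 → Fin (3 * n)
  liftPoint i j B α = point (corner B α) (layers i j α)

  liftPoint-injective : ∀ i j B → Injective _≡_ _≡_ (liftPoint i j B)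
  liftPoint-injective i j B {α} {β} =
    corner-injective B ∘ proj₁ ∘ point-injective (corner B α) (layers i j α) (corner B β) (layers i j β)

  lift : Fin 3 → Fin 3 → Block n → Block (3 * n)
  lift i j B = tripleBlock (liftPoint i j B) (liftPoint-injective i j B)

  ∈lift⁻ : ∀ i j B {x} → x ∈B lift i j B → ∃[ α ] (column x ≡ corner B α × layer x ≡ layers i j α)
  ∈lift⁻ i j B x∈ with ∈tripleBlock⁻ (liftPoint i j B) (liftPoint-injective i j B) x∈
  ... | α , refl = α , column-point (corner B α) (layers i j α) , layer-point (corner B α) (layers i j α)

  ∈lift⁺ : ∀ i j B {x} α → column x ≡ corner B α → layer x ≡ layers i j α → x ∈B lift i j B
  ∈lift⁺ i j B α cx lx = ∈tripleBlock⁺ (liftPoint i j B) (liftPoint-injective i j B) α (≡point cx lx)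

  blockSum-lift : ∀ i j B → blockSum (lift i j B) ≡ blockSum B + n * (toℕ i + toℕ j + toℕ (third i j))
  blockSum-lift i j B = begin
    blockSum (lift i j B)
      ≡⟨ blockSum-tripleBlock (liftPoint i j B) (liftPoint-injective i j B) ⟩
    toℕ (liftPoint i j B 0F) + toℕ (liftPoint i j B 1F) + toℕ (liftPoint i j B 2F)
      ≡⟨ cong₂ _+_ (cong₂ _+_ (toℕ-point _ _) (toℕ-point _ _)) (toℕ-point _ _) ⟩
    n * toℕ i + toℕ (a B) + (n * toℕ j + toℕ (b B)) + (n * toℕ (third i j) + toℕ (c B))
      ≡⟨ regroup n (toℕ i) (toℕ j) (toℕ (third i j)) (toℕ (a B)) (toℕ (b B)) (toℕ (c B)) ⟩
    blockSum B + n * (toℕ i + toℕ j + toℕ (third i j)) ∎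
    where
    open ≡-Reasoning
    regroup : ∀ n i j k a b c → n * i + a + (n * j + b) + (n * k + c) ≡ a + b + c + n * (i + j + k)
    regroup = solve-∀

  ∈lift-column-injective : ∀ i j B {x y} → x ∈B lift i j B → y ∈B lift i j B → column x ≡ column y → x ≡ y
  ∈lift-column-injective i j B x∈ y∈ same with ∈lift⁻ i j B x∈ | ∈lift⁻ i j B y∈
  ... | α , cx , lx | β , cy , ly with corner-injective B {α} {β} (trans (sym cx) (trans same cy))
  ... | refl = column-layer-injective same (trans lx (sym ly))

  vertical≢lift : ∀ u i j B → vertical u ≢ lift i j B
  vertical≢lift u i j B e =
    case proj₂ (point-injective u 0F u 1F (∈lift-column-injective i j B (on-lift 0F) (on-lift 1F) same-column))
    of λ ()
    where
    on-lift : ∀ t → point u t ∈B lift i j B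
    on-lift t = subst (point u t ∈B_) e (∈vertical⁺ u (column-point u t))
    same-column : column (point u 0F) ≡ column (point u 1F)
    same-column = trans (column-point u 0F) (sym (column-point u 1F))

module Tripling {n : ℕ} {𝓑 : List (Block n)} (kts : IsKTS n 𝓑) where
  open Tripled n
  open IsKTS kts
  open IsSTS sts using (covered; onlyOnce) renaming (unique to 𝓑-unique)
  open Resolution resolvable

  resolved : List (Block n)
  resolved = concat classes

  resolved⊆𝓑 : ∀ {B} → B ∈ resolved → B ∈ 𝓑
  resolved⊆𝓑 = ∈-resp-↭ partition

  𝓑⊆resolved : ∀ {B} → B ∈ 𝓑 → B ∈ resolved
  𝓑⊆resolved = ∈-resp-↭ (↭-sym partition)

  resolved-unique : Unique resolved
  resolved-unique = Unique-resp-↭ (setoid (Block n)) (↭⇒↭ₛ (↭-sym partition)) 𝓑-unique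

  lift-determined : ∀ i j i′ j′ {B B′ x y} → B ∈ 𝓑 → B′ ∈ 𝓑 → column x ≢ column y →
    x ∈B lift i j B → y ∈B lift i j B → x ∈B lift i′ j′ B′ → y ∈B lift i′ j′ B′ →
    B ≡ B′ × i ≡ i′ × j ≡ j′
  lift-determined i j i′ j′ {B} {B′} B∈ B′∈ cx≢cy x∈ y∈ x∈′ y∈′
    with ∈lift⁻ i j B x∈ | ∈lift⁻ i j B y∈ | ∈lift⁻ i′ j′ B′ x∈′ | ∈lift⁻ i′ j′ B′ y∈′
  ... | α , cx , lx | β , cy , ly | α′ , cx′ , lx′ | β′ , cy′ , ly′
    with onlyOnce _ _ cx≢cy B B′ B∈ B′∈
           (corner⇒∈B B α cx) (corner⇒∈B B β cy) (corner⇒∈B B′ α′ cx′) (corner⇒∈B B′ β′ cy′)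
  ... | refl
    with corner-injective B {α} {α′} (trans (sym cx) cx′) | corner-injective B {β} {β′} (trans (sym cy) cy′)
  ... | refl | refl = refl , layers-pair-injective α β i j i′ j′ α≢β (trans (sym lx) lx′) (trans (sym ly) ly′)
    where
    α≢β : α ≢ β
    α≢β refl = cx≢cy (trans cx (sym cy))

  lift-injective : ∀ i j i′ j′ {B B′} → B ∈ 𝓑 → B′ ∈ 𝓑 → lift i j B ≡ lift i′ j′ B′ →
    B ≡ B′ × i ≡ i′ × j ≡ j′
  lift-injective i j i′ j′ {B} B∈ B′∈ e =
    lift-determined i j i′ j′ B∈ B′∈ distinct-columns (on-lift 0F) (on-lift 1F)
      (subst (_ ∈B_) e (on-lift 0F)) (subst (_ ∈B_) e (on-lift 1F))
    where
    on-lift : ∀ α → liftPoint i j B α ∈B lift i j B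
    on-lift α = ∈tripleBlock⁺ (liftPoint i j B) (liftPoint-injective i j B) α refl
    distinct-columns : column (liftPoint i j B 0F) ≢ column (liftPoint i j B 1F)
    distinct-columns e′ =
      case corner-injective B {0F} {1F} (trans (sym (column-liftPoint 0F)) (trans e′ (column-liftPoint 1F)))
      of λ ()
      where
      column-liftPoint : ∀ α → column (liftPoint i j B α) ≡ corner B α
      column-liftPoint α = column-point (corner B α) (layers i j α)

  diagonal : Fin 3 → Block n → List (Block (3 * n))
  diagonal s B = map (λ i → lift i (i ⊕ s) B) (allFin 3)

  liftedClass : Fin 3 → List (Block n) → List (Block (3 * n))
  liftedClass s = concatMap (diagonal s)

  ∈liftedClass⁻ : ∀ s {P C} → C ∈ liftedClass s P → ∃₂ λ i B → B ∈ P × C ≡ lift i (i ⊕ s) B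
  ∈liftedClass⁻ s C∈ with find (∈-concatMap⁻ (diagonal s) C∈)
  ... | B , B∈P , C∈diagonal with ∈-map⁻ (λ i → lift i (i ⊕ s) B) C∈diagonal
  ... | i , _ , C≡ = i , B , B∈P , C≡

  ∈liftedClass⁺ : ∀ s {P B} → B ∈ P → ∀ i → lift i (i ⊕ s) B ∈ liftedClass s P
  ∈liftedClass⁺ s {B = B} B∈P i =
    ∈-concatMap⁺ (diagonal s) (lose B∈P (∈-map⁺ (λ i → lift i (i ⊕ s) B) (∈-allFin i)))

  liftedClass-unique : ∀ s {P} → Unique P → (∀ {B} → B ∈ P → B ∈ 𝓑) → Unique (liftedClass s P)
  liftedClass-unique s P! P⊆𝓑 = Unique-concatMap⁺ (diagonal s) P! diagonal-unique determined
    where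
    diagonal-unique : ∀ {B} → B ∈ _ → Unique (diagonal s B)
    diagonal-unique B∈P =
      map⁺ (λ {i} {i′} → proj₁ ∘ proj₂ ∘ lift-injective i (i ⊕ s) i′ (i′ ⊕ s) B∈𝓑 B∈𝓑) (allFin⁺ 3)
      where B∈𝓑 = P⊆𝓑 B∈P
    determined : ∀ {B B′ C} → B ∈ _ → B′ ∈ _ → C ∈ diagonal s B → C ∈ diagonal s B′ → B ≡ B′
    determined {B} {B′} B∈P B′∈P C∈ C∈′
      with ∈-map⁻ (λ i → lift i (i ⊕ s) B) C∈ | ∈-map⁻ (λ i → lift i (i ⊕ s) B′) C∈′
    ... | i , _ , refl | i′ , _ , e =
      proj₁ (lift-injective i (i ⊕ s) i′ (i′ ⊕ s) (P⊆𝓑 B∈P) (P⊆𝓑 B′∈P) e)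

  verticalClass : List (Block (3 * n))
  verticalClass = map vertical (allFin n)

  lifts : List (Block (3 * n))
  lifts = concatMap (λ s → liftedClass s resolved) (allFin 3)

  liftedClasses : List (List (Block (3 * n)))
  liftedClasses = concatMap (λ s → map (liftedClass s) classes) (allFin 3)

  concat-liftedClasses : concat liftedClasses ≡ lifts
  concat-liftedClasses = trans (concat-concatMap (λ s → map (liftedClass s) classes) (allFin 3))
    (concatMap-cong (λ s → concat-map-concatMap (diagonal s) classes) (allFin 3))

  𝓑′ : List (Block (3 * n))
  𝓑′ = verticalClass ++ lifts

  classes′ : List (List (Block (3 * n)))
  classes′ = verticalClass ∷ liftedClasses

  vertical∈𝓑′ : ∀ u → vertical u ∈ 𝓑′
  vertical∈𝓑′ u = ∈-++⁺ˡ (∈-map⁺ vertical (∈-allFin u))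

  lift∈𝓑′ : ∀ {B} → B ∈ 𝓑 → ∀ i j → lift i j B ∈ 𝓑′
  lift∈𝓑′ {B} B∈ i j = ∈-++⁺ʳ verticalClass (subst (_∈ lifts) (cong (λ k → lift i k B) (⊕-⊖-cancel i j))
    (∈-concatMap⁺ (λ s → liftedClass s resolved)
      (lose (∈-allFin (j ⊖ i)) (∈liftedClass⁺ (j ⊖ i) (𝓑⊆resolved B∈) i))))

  data Kind : Block (3 * n) → Set where
    vert   : ∀ u → Kind (vertical u)
    lifted : ∀ i j B → B ∈ 𝓑 → Kind (lift i j B)

  ∈lifts⁻ : ∀ {C} → C ∈ lifts → ∃[ i ] ∃[ j ] ∃[ B ] (B ∈ 𝓑 × C ≡ lift i j B)
  ∈lifts⁻ C∈ with find (∈-concatMap⁻ (λ s → liftedClass s resolved) {allFin 3} C∈)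
  ... | s , _ , C∈s with ∈liftedClass⁻ s C∈s
  ... | i , B , B∈ , C≡ = i , i ⊕ s , B , resolved⊆𝓑 B∈ , C≡

  kind : ∀ {C} → C ∈ 𝓑′ → Kind C
  kind {C} C∈ = [ vertical-kind ∘ ∈-map⁻ vertical , lift-kind ∘ ∈lifts⁻ ] (∈-++⁻ verticalClass C∈)
    where
    vertical-kind : ∃[ u ] (u ∈ allFin n × C ≡ vertical u) → Kind C
    vertical-kind (u , _ , refl) = vert u
    lift-kind : ∃[ i ] ∃[ j ] ∃[ B ] (B ∈ 𝓑 × C ≡ lift i j B) → Kind C
    lift-kind (i , j , B , B∈ , refl) = lifted i j B B∈

  𝓑′-unique : Unique 𝓑′
  𝓑′-unique = ++⁺ (map⁺ vertical-injective (allFin⁺ n)) lifts-unique vertical∉lifts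
    where
    lifts-unique : Unique lifts
    lifts-unique = Unique-concatMap⁺ (λ s → liftedClass s resolved) {allFin 3} (allFin⁺ 3)
      (λ _ → liftedClass-unique _ resolved-unique resolved⊆𝓑)
      λ {s} {s′} _ _ C∈ C∈′ → same-offset (∈liftedClass⁻ s C∈) (∈liftedClass⁻ s′ C∈′)
      where
      same-offset : ∀ {s s′ C} → ∃₂ (λ i B → B ∈ resolved × C ≡ lift i (i ⊕ s) B) →
        ∃₂ (λ i B → B ∈ resolved × C ≡ lift i (i ⊕ s′) B) → s ≡ s′
      same-offset {s} {s′} (i , B , B∈ , refl) (i′ , B′ , B′∈ , e)
        with lift-injective i (i ⊕ s) i′ (i′ ⊕ s′) (resolved⊆𝓑 B∈) (resolved⊆𝓑 B′∈) e
      ... | _ , refl , i⊕s≡i⊕s′ = ⊕-cancelˡ i _ _ i⊕s≡i⊕s′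
    vertical∉lifts : Disjoint verticalClass lifts
    vertical∉lifts (C∈V , C∈L) = apart (∈-map⁻ vertical C∈V) (∈lifts⁻ C∈L)
      where
      apart : ∀ {C} → ∃[ u ] (u ∈ allFin n × C ≡ vertical u) →
        ∃[ i ] ∃[ j ] ∃[ B ] (B ∈ 𝓑 × C ≡ lift i j B) → ⊥
      apart (u , _ , refl) (i , j , B , _ , e) = vertical≢lift u i j B e

  covered′ : ∀ x y → x ≢ y → ∃[ C ] (C ∈ 𝓑′ × x ∈B C × y ∈B C)
  covered′ x y _ with column x ≟ column y
  ... | yes same = vertical (column x) , vertical∈𝓑′ _ , ∈vertical⁺ _ refl , ∈vertical⁺ _ (sym same)
  ... | no differ = lift-through (covered (column x) (column y) differ)
    where
    lift-through : ∃[ B ] (B ∈ 𝓑 × column x ∈B B × column y ∈B B) →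
      ∃[ C ] (C ∈ 𝓑′ × x ∈B C × y ∈B C)
    lift-through (B , B∈ , cx∈B , cy∈B) =
      let α , cx = ∈B⇒corner B cx∈B
          β , cy = ∈B⇒corner B cy∈B
          i , j , lx , ly = layers-pair-surjective α β (layer x) (layer y)
                              (λ α≡β → differ (trans cx (trans (cong (corner B) α≡β) (sym cy))))
      in lift i j B , lift∈𝓑′ B∈ i j , ∈lift⁺ i j B α cx (sym lx) , ∈lift⁺ i j B β cy (sym ly)

  only-block-through : ∀ {x y C C′} → x ≢ y → Kind C → Kind C′ →
    x ∈B C → y ∈B C → x ∈B C′ → y ∈B C′ → C ≡ C′
  only-block-through _ (vert u) (vert u′) x∈ _ x∈′ _ = verticals-through u u′ x∈ x∈′
  only-block-through x≢y (vert u) (lifted i j B _) x∈ y∈ x∈′ y∈′ =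
    ⊥-elim (x≢y (∈lift-column-injective i j B x∈′ y∈′ (∈vertical-same-column u x∈ y∈)))
  only-block-through x≢y (lifted i j B _) (vert u) x∈ y∈ x∈′ y∈′ =
    ⊥-elim (x≢y (∈lift-column-injective i j B x∈ y∈ (∈vertical-same-column u x∈′ y∈′)))
  only-block-through {x} {y} x≢y (lifted i j B B∈) (lifted i′ j′ B′ B′∈) x∈ y∈ x∈′ y∈′
    with column x ≟ column y
  ... | yes same = ⊥-elim (x≢y (∈lift-column-injective i j B x∈ y∈ same))
  ... | no differ with lift-determined i j i′ j′ B∈ B′∈ differ x∈ y∈ x∈′ y∈′
  ... | refl , refl , refl = refl

  isSTS′ : IsSTS (3 * n) 𝓑′
  isSTS′ = record
    { unique   = 𝓑′-unique
    ; covered  = covered′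
    ; onlyOnce = λ _ _ x≢y _ _ C∈ C′∈ → only-block-through x≢y (kind C∈) (kind C′∈)
    }

  verticalClass-parallel : IsParallelClass (3 * n) verticalClass
  verticalClass-parallel = record
    { unique   = map⁺ vertical-injective (allFin⁺ n)
    ; covers   = λ x → vertical (column x) , ∈-map⁺ vertical (∈-allFin _) , ∈vertical⁺ _ refl
    ; disjoint = disjoint
    }
    where
    disjoint : ∀ x C C′ → C ∈ verticalClass → C′ ∈ verticalClass → x ∈B C → x ∈B C′ → C ≡ C′
    disjoint x C C′ C∈ C′∈ with ∈-map⁻ vertical C∈ | ∈-map⁻ vertical C′∈
    ... | u , _ , refl | u′ , _ , refl = verticals-through u u′

  liftedClass-parallel : ∀ s {P} → P ∈ classes → IsParallelClass (3 * n) (liftedClass s P)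
  liftedClass-parallel s {P} P∈ = record
    { unique   = liftedClass-unique s P-unique P⊆𝓑
    ; covers   = covers
    ; disjoint = disjoint
    }
    where
    open IsParallelClass (isParallel P P∈) renaming (unique to P-unique; covers to P-covers; disjoint to P-disjoint)
    P⊆𝓑 : ∀ {B} → B ∈ P → B ∈ 𝓑
    P⊆𝓑 B∈P = resolved⊆𝓑 (∈-concat⁺′ B∈P P∈)
    covers : ∀ x → ∃[ C ] (C ∈ liftedClass s P × x ∈B C)
    covers x with P-covers (column x)
    ... | B , B∈P , cx∈B with ∈B⇒corner B cx∈B
    ... | α , cx with diagonal-layer-surjective α s (layer x)
    ... | i , lx = lift i (i ⊕ s) B , ∈liftedClass⁺ s B∈P i , ∈lift⁺ i (i ⊕ s) B α cx (sym lx)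
    disjoint : ∀ x C C′ → C ∈ liftedClass s P → C′ ∈ liftedClass s P → x ∈B C → x ∈B C′ → C ≡ C′
    disjoint x C C′ C∈ C′∈ x∈ x∈′ with ∈liftedClass⁻ s C∈ | ∈liftedClass⁻ s C′∈
    ... | i , B , B∈P , refl | i′ , B′ , B′∈P , refl
      with ∈lift⁻ i (i ⊕ s) B x∈ | ∈lift⁻ i′ (i′ ⊕ s) B′ x∈′
    ... | α , cx , lx | α′ , cx′ , lx′
      with P-disjoint (column x) B B′ B∈P B′∈P (corner⇒∈B B α cx) (corner⇒∈B B′ α′ cx′)
    ... | refl with corner-injective B {α} {α′} (trans (sym cx) cx′)
    ... | refl with diagonal-point-injectiveʳ α s i i′ (trans (sym lx) lx′)
    ... | refl = refl

  classes′-parallel : ∀ P′ → P′ ∈ classes′ → IsParallelClass (3 * n) P′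
  classes′-parallel _ (here refl) = verticalClass-parallel
  classes′-parallel _ (there P′∈)
    with find (∈-concatMap⁻ (λ s → map (liftedClass s) classes) {allFin 3} P′∈)
  ... | s , _ , P′∈s with ∈-map⁻ (liftedClass s) P′∈s
  ... | P , P∈ , refl = liftedClass-parallel s P∈

  isKTS′ : IsKTS (3 * n) 𝓑′
  isKTS′ = record
    { sts        = isSTS′
    ; resolvable = record
      { classes    = classes′
      ; isParallel = classes′-parallel
      ; partition  = ↭-reflexive (cong (verticalClass ++_) concat-liftedClasses)
      }
    }

  minSum′ : MinSumIs 𝓑 n → MinSumIs 𝓑′ (3 * n)
  minSum′ ((B₀ , B₀∈ , ΣB₀≡n) , sums≥n) =
    (lift 0F 0F B₀ , lift∈𝓑′ B₀∈ 0F 0F ,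
     trans (blockSum-lift 0F 0F B₀) (trans (cong (_+ n * 2) ΣB₀≡n) (n+2n n))) ,
    λ C C∈ → sum≥ (kind C∈)
    where
    open ≤-Reasoning
    n+2n : ∀ n → n + n * 2 ≡ 3 * n
    n+2n = solve-∀
    sum≥ : ∀ {C} → Kind C → blockSum C ≥ 3 * n
    sum≥ (vert u) = begin
      3 * n                 ≤⟨ m≤m+n (3 * n) (3 * toℕ u) ⟩
      3 * n + 3 * toℕ u     ≡⟨ blockSum-vertical u ⟨
      blockSum (vertical u) ∎
    sum≥ (lifted i j B B∈) = begin
      3 * n                                               ≡⟨ n+2n n ⟨
      n + n * 2                                           ≤⟨ +-mono-≤ (sums≥n B B∈) (*-monoʳ-≤ n (layers-sum≥2 i j)) ⟩
      blockSum B + n * (toℕ i + toℕ j + toℕ (third i j)) ≡⟨ blockSum-lift i j B ⟨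
      blockSum (lift i j B)                               ∎

mainTheorem1 : ∀ (n : ℕ) → .{{_ : NonZero n}} → (𝓑 : List (Block n)) →
                 IsKTS n 𝓑 → MinSumIs 𝓑 n →
                 ∃[ 𝓑′ ] (IsKTS (3 * n) 𝓑′ × MinSumIs 𝓑′ (3 * n))
mainTheorem1 n 𝓑 kts minSum = 𝓑′ , isKTS′ , minSum′ minSum
  where open Tripling kts
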